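{- There is an absolute constant $C$ such that the following holds. Let $q\geq C$ be a prime power and $E\subset\mathbb{F}_q^2$ with $|E|\geq 64q\log_2 q$. Let $\mathcal{L}$ be the set of all lines in $\mathbb{F}_q^2$ containing at least two points of $E$ and containing between $1+\frac{|E|}{2q}$ and $2\frac{|E|}{q}$ points of $E$. Then at least $\frac{|E|^2}{4}$ unordered pairs of distinct points of $E$ lie on (are supported by) lines of $\mathcal{L}$.
   Context: A line in $\mathbb{F}_q^2$ is a set $\{a+sb: s\in\mathbb{F}_q\}$ with $a\in\mathbb{F}_q^2$, $b\neq 0$. An unordered pair $\{e_1,e_2\}$ of distinct points is supported on $\mathcal{L}$ if the unique line through $e_1$ and $e_2$ belongs to $\mathcal{L}$. -}

module Defs where

open import Data.Nat using (ℕ; _+_; _*_; _≤ᵇ_; _/_)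
open import Data.Bool using (Bool; _∧_; not)
open import Data.Fin using (Fin)
open import Data.List using (List; map; allFin; cartesianProduct; filterᵇ; length)
open import Data.Bool.ListAction using (any)
open import Data.Product using (_×_; _,_; ∃)
open import Data.Product.Properties using (≡-dec)
open import Relation.Nullary using (does)
open import Relation.Binary.PropositionalEquality using (_≡_; _≢_)
open import Relation.Binary.Definitions using (DecidableEquality)
open import Algebra.Core using (Op₁; Op₂)
open import Algebra.Structures using (IsCommutativeRing)
open import Function.Bundles using (_↔_; Inverse)

-- Its order 'size' is the q of the paper
-- (the orders of finite fields are exactly the prime powers).
record FiniteField : Set₁ where
  field
    Carrier : Set
    _+F_ _*F_ : Op₂ Carrier
    -F_ : Op₁ Carrier
    0# 1# : Carrier
    isCommutativeRing : IsCommutativeRing _≡_ _+F_ _*F_ -F_ 0# 1#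
    0≢1 : 0# ≢ 1#
    inv : ∀ x → x ≢ 0# → ∃ λ y → x *F y ≡ 1#
    _≟_ : DecidableEquality Carrier
    size : ℕ
    enum : Fin size ↔ Carrier

module _ (F : FiniteField) where
  open FiniteField F

  Pt : Set
  Pt = Carrier × Carrier

  _≟ₚ_ : DecidableEquality Pt
  _≟ₚ_ = ≡-dec _≟_ _≟_

  _+ₚ_ : Pt → Pt → Pt
  (a₁ , a₂) +ₚ (b₁ , b₂) = (a₁ +F b₁) , (a₂ +F b₂)

  _-ₚ_ : Pt → Pt → Pt
  (a₁ , a₂) -ₚ (b₁ , b₂) = (a₁ +F (-F b₁)) , (a₂ +F (-F b₂))

  _·ₚ_ : Carrier → Pt → Pt
  s ·ₚ (b₁ , b₂) = (s *F b₁) , (s *F b₂)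

  elems : List Carrier
  elems = map (Inverse.to enum) (allFin size)

  points : List Pt
  points = cartesianProduct elems elems

  countPts : (Pt → Bool) → ℕ
  countPts P = length (filterᵇ P points)

  onLine : Pt → Pt → Pt → Bool
  onLine a b p = any (λ s → does (p ≟ₚ (a +ₚ (s ·ₚ b)))) elems

  card : (Pt → Bool) → ℕ
  card E = countPts E

  lineCount : (Pt → Bool) → Pt → Pt → ℕ
  lineCount E a b = countPts (λ p → E p ∧ onLine a b p)

  -- the line {a + s b} belongs to 𝓛:  |ℓ ∩ E| ≥ 2  and
  -- 1 + |E|/(2q) ≤ |ℓ ∩ E| ≤ 2|E|/q   (cleared of denominators)
  inL : (Pt → Bool) → Pt → Pt → Bool
  inL E a b = let k = lineCount E a b ; n = card E in
    (2 ≤ᵇ k) ∧ ((2 * size + n ≤ᵇ 2 * size * k) ∧ (size * k ≤ᵇ 2 * n))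

  supported : (Pt → Bool) → Pt → Pt → Bool
  supported E e₁ e₂ = inL E e₁ (e₂ -ₚ e₁)

  orderedSupportedPairs : (Pt → Bool) → ℕ
  orderedSupportedPairs E =
    length (filterᵇ (λ { (e₁ , e₂) → E e₁ ∧ (E e₂ ∧ (not (does (e₁ ≟ₚ e₂)) ∧ supported E e₁ e₂)) })
                    (cartesianProduct points points))

  -- unordered pairs: each unordered pair is counted twice among ordered ones
  unorderedSupportedPairs : (Pt → Bool) → ℕ
  unorderedSupportedPairs E = orderedSupportedPairs E / 2

module Submission where

open import Defs
open import Data.Nat using (ℕ; _≤_; _*_; _^_)
open import Data.Product using (∃-syntax)
open import Data.Bool using (Bool)
open import Data.Product using (_,_)

-- Rich and poor lines carry few pairs (a variance argument).
--
-- Represent the q(q + 1) lines of F_q² as "based lines" (p , d): a base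
-- point p and one of the q + 1 normalised directions d; each line then
-- occurs q times.  Write k(ℓ) = |ℓ ∩ E| and n = |E|.
--
--  * Through a point e ∈ E pass q + 1 lines, covering E once and e itself
--    q + 1 times, so Σ_{ℓ ∋ e} k(ℓ) = n + q.  Splitting this sum into lines
--    in 𝓛 and lines outside 𝓛 shows that e has at least
--    n - 1 - B(e) partners x with {e , x} supported on 𝓛, where B(e) counts
--    the points on the lines through e outside 𝓛.  Summing over e ∈ E:
--    n² ≤ (ordered supported pairs) + n + B.
--  * Double counting incidences gives the moments Σ_ℓ k², Σ_ℓ k, Σ_ℓ 1 and
--    B = Σ_{ℓ ∉ 𝓛} k².  For ℓ ∉ 𝓛 the value qk is far from n, so
--    (qk)² ≤ 16 (qk - n)²; summing, B ≤ 16 Σ_ℓ (k - n/q)² ≤ 16 q n.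
--  * With n ≥ 64 q log₂ q and q ≥ 2¹⁰ we have n ≥ 640 q, and then
--    n² ≤ G + n + 16 q n forces G ≥ n²/2, i.e. n²/4 unordered pairs.

module Decisions where

  open import Data.Bool using (true; T)
  open import Data.Unit using (tt)
  open import Relation.Nullary using (Dec; does; yes; no)
  open import Relation.Nullary.Decidable using (does-⇔; T?)
  open import Relation.Binary.PropositionalEquality using (_≡_; refl)
  open import Function using (mk⇔)

  true⇒T : ∀ {b} → b ≡ true → T b
  true⇒T refl = tt

  T-injective : ∀ {a b} → (T a → T b) → (T b → T a) → a ≡ b
  T-injective {a} {b} a⇒b b⇒a = does-⇔ (mk⇔ a⇒b b⇒a) (T? a) (T? b)

  does-sound : ∀ {P : Set} (d : Dec P) → T (does d) → P
  does-sound (yes p) _ = p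

  does-complete : ∀ {P : Set} (d : Dec P) → P → T (does d)
  does-complete (yes _) _ = tt
  does-complete (no ¬p) p = ¬p p

module FiniteSums where

  open import Data.Nat using (ℕ; suc; _+_; _*_; _≤_; z≤n)
  open import Data.Nat.Properties
  open import Algebra.Properties.CommutativeSemigroup +-commutativeSemigroup using () renaming (interchange to +-interchange)
  open import Data.Bool using (Bool; true; false; _∧_; not; T)
  open import Data.List using (List; []; _∷_; map; length; filterᵇ; cartesianProduct; _++_)
  open import Data.Product using (_×_; _,_)
  open import Relation.Binary.PropositionalEquality
  open import Function using (_∘_)
  open import Data.List.Membership.Propositional using (_∈_)
  open import Data.List.Relation.Unary.Any using (here; there)

  private variable A B : Set

  ∑ : List A → (A → ℕ) → ℕ
  ∑ []       f = 0
  ∑ (x ∷ xs) f = f x + ∑ xs f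

  syntax ∑ xs (λ x → e) = ∑[ x ← xs ] e

  𝟙 : Bool → ℕ
  𝟙 true  = 1
  𝟙 false = 0

  𝟙-∧ : ∀ a b → 𝟙 (a ∧ b) ≡ 𝟙 a * 𝟙 b
  𝟙-∧ true  b = sym (+-identityʳ (𝟙 b))
  𝟙-∧ false b = refl

  𝟙-T : ∀ {b} → T b → 𝟙 b ≡ 1
  𝟙-T {true} _ = refl

  𝟙≤1 : ∀ b → 𝟙 b ≤ 1
  𝟙≤1 true  = ≤-refl
  𝟙≤1 false = z≤n

  𝟙-split : ∀ b k → k ≡ 𝟙 b * k + 𝟙 (not b) * k
  𝟙-split true  k = sym (trans (+-identityʳ (1 * k)) (*-identityˡ k))
  𝟙-split false k = sym (*-identityˡ k)

  length-filter : (P : A → Bool) (xs : List A) → length (filterᵇ P xs) ≡ ∑[ x ← xs ] 𝟙 (P x)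
  length-filter P [] = refl
  length-filter P (x ∷ xs) with P x
  ... | true  = cong suc (length-filter P xs)
  ... | false = length-filter P xs

  ∑-cong : (xs : List A) {f g : A → ℕ} → (∀ x → f x ≡ g x) → ∑ xs f ≡ ∑ xs g
  ∑-cong []       f≡g = refl
  ∑-cong (x ∷ xs) f≡g = cong₂ _+_ (f≡g x) (∑-cong xs f≡g)

  ∑-cong-∈ : (xs : List A) {f g : A → ℕ} → (∀ {x} → x ∈ xs → f x ≡ g x) → ∑ xs f ≡ ∑ xs g
  ∑-cong-∈ []       f≡g = refl
  ∑-cong-∈ (x ∷ xs) f≡g = cong₂ _+_ (f≡g (here refl)) (∑-cong-∈ xs (f≡g ∘ there))

  ∑-mono : (xs : List A) {f g : A → ℕ} → (∀ x → f x ≤ g x) → ∑ xs f ≤ ∑ xs g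
  ∑-mono []       f≤g = z≤n
  ∑-mono (x ∷ xs) f≤g = +-mono-≤ (f≤g x) (∑-mono xs f≤g)

  ∑-const : (xs : List A) (c : ℕ) → ∑[ _ ← xs ] c ≡ length xs * c
  ∑-const []       c = refl
  ∑-const (x ∷ xs) c = cong (c +_) (∑-const xs c)

  ∑-zero : (xs : List A) → ∑[ _ ← xs ] 0 ≡ 0
  ∑-zero xs = trans (∑-const xs 0) (*-zeroʳ (length xs))

  ∑-+ : (xs : List A) (f g : A → ℕ) → ∑[ x ← xs ] (f x + g x) ≡ ∑ xs f + ∑ xs g
  ∑-+ []       f g = refl
  ∑-+ (x ∷ xs) f g = trans (cong (f x + g x +_) (∑-+ xs f g)) (+-interchange (f x) (g x) (∑ xs f) (∑ xs g))

  ∑-*ˡ : (xs : List A) (c : ℕ) (f : A → ℕ) → ∑[ x ← xs ] (c * f x) ≡ c * ∑ xs f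
  ∑-*ˡ []       c f = sym (*-zeroʳ c)
  ∑-*ˡ (x ∷ xs) c f = trans (cong (c * f x +_) (∑-*ˡ xs c f)) (sym (*-distribˡ-+ c (f x) (∑ xs f)))

  ∑-*ʳ : (xs : List A) (c : ℕ) (f : A → ℕ) → ∑[ x ← xs ] (f x * c) ≡ ∑ xs f * c
  ∑-*ʳ xs c f = trans (∑-cong xs (λ x → *-comm (f x) c)) (trans (∑-*ˡ xs c f) (*-comm c (∑ xs f)))

  ∑-++ : (xs ys : List A) (f : A → ℕ) → ∑ (xs ++ ys) f ≡ ∑ xs f + ∑ ys f
  ∑-++ []       ys f = refl
  ∑-++ (x ∷ xs) ys f = trans (cong (f x +_) (∑-++ xs ys f)) (sym (+-assoc (f x) (∑ xs f) (∑ ys f)))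

  ∑-map : (xs : List A) (g : A → B) (f : B → ℕ) → ∑ (map g xs) f ≡ ∑ xs (f ∘ g)
  ∑-map []       g f = refl
  ∑-map (x ∷ xs) g f = cong (f (g x) +_) (∑-map xs g f)

  ∑-swap : (xs : List A) (ys : List B) (f : A → B → ℕ) →
           ∑[ x ← xs ] ∑[ y ← ys ] f x y ≡ ∑[ y ← ys ] ∑[ x ← xs ] f x y
  ∑-swap []       ys f = sym (∑-zero ys)
  ∑-swap (x ∷ xs) ys f = trans (cong (∑ ys (f x) +_) (∑-swap xs ys f)) (sym (∑-+ ys (f x) _))

  ∑-cartesian : (xs : List A) (ys : List B) (f : A × B → ℕ) →
                ∑ (cartesianProduct xs ys) f ≡ ∑[ x ← xs ] ∑[ y ← ys ] f (x , y)
  ∑-cartesian []       ys f = refl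
  ∑-cartesian (x ∷ xs) ys f =
    trans (∑-++ (map (x ,_) ys) _ f) (cong₂ _+_ (∑-map ys (x ,_) f) (∑-cartesian xs ys f))

module Enumerations where

  open FiniteSums
  open Decisions
  open import Data.Nat using (ℕ; suc; _+_; _*_)
  open import Data.Nat.Properties using (*-identityˡ; *-identityʳ)
  open import Data.Bool using (Bool; true; false; T)
  open import Data.Bool.ListAction using (any)
  open import Data.List using (List; []; _∷_; map; allFin; cartesianProduct)
  open import Data.List.Properties using (map-tabulate)
  open import Data.List.Membership.Propositional using (_∈_)
  open import Data.List.Relation.Unary.Any using (here; there; satisfied)
  import Data.List.Relation.Unary.Any as Any
  open import Data.List.Relation.Unary.Any.Properties using (any⁺; any⁻)
  open import Data.Fin as Fin using (Fin)
  open import Data.Empty using (⊥-elim)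
  open import Data.Product using (_×_; _,_)
  open import Data.Product.Properties using (≡-dec)
  open import Relation.Nullary using (does; yes; no; _×-dec_)
  open import Relation.Nullary.Decidable using (does-⇔)
  open import Relation.Binary.Definitions using (DecidableEquality)
  open import Relation.Binary.PropositionalEquality
  open import Function using (id; mk⇔)
  open import Function.Bundles using (_↔_; _⇔_; Inverse)

  private variable A B : Set

  record Enumerates (_≟_ : DecidableEquality A) (xs : List A) : Set where
    constructor counting
    field counts-once : ∀ c → ∑[ x ← xs ] 𝟙 (does (x ≟ c)) ≡ 1

  open Enumerates public

  module _ {_≟_ : DecidableEquality A} {xs : List A} (enum : Enumerates _≟_ xs) where

    ∑-delta : ∀ c (g : A → ℕ) → ∑[ x ← xs ] (𝟙 (does (x ≟ c)) * g x) ≡ g c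
    ∑-delta c g = begin
      ∑[ x ← xs ] (𝟙 (does (x ≟ c)) * g x) ≡⟨ ∑-cong xs at-c ⟩
      ∑[ x ← xs ] (𝟙 (does (x ≟ c)) * g c) ≡⟨ ∑-*ʳ xs (g c) _ ⟩
      ∑[ x ← xs ] 𝟙 (does (x ≟ c)) * g c   ≡⟨ cong (_* g c) (counts-once enum c) ⟩
      1 * g c                              ≡⟨ *-identityˡ (g c) ⟩
      g c                                  ∎
      where
      open ≡-Reasoning
      at-c : ∀ x → 𝟙 (does (x ≟ c)) * g x ≡ 𝟙 (does (x ≟ c)) * g c
      at-c x with x ≟ c
      ... | yes refl = refl
      ... | no  _    = refl

    enumerated : ∀ c → c ∈ xs
    enumerated c = occurs xs (counts-once enum c)
      where
      occurs : ∀ ys → ∑[ y ← ys ] 𝟙 (does (y ≟ c)) ≡ 1 → c ∈ ys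
      occurs (y ∷ ys) count with y ≟ c
      ... | yes refl = here refl
      ... | no  _    = there (occurs ys count)

    any-intro : (P : A → Bool) (c : A) → T (P c) → T (any P xs)
    any-intro P c Pc = any⁺ P (Any.map (λ { refl → Pc }) (enumerated c))

    𝟙-any : (P : A → Bool) → (∀ s s′ → T (P s) → T (P s′) → s ≡ s′) →
            𝟙 (any P xs) ≡ ∑[ s ← xs ] 𝟙 (P s)
    𝟙-any P unique with any P xs in found
    ... | false = sym (none xs found)
      where
      none : ∀ ys → any P ys ≡ false → ∑[ s ← ys ] 𝟙 (P s) ≡ 0
      none []       _ = refl
      none (y ∷ ys) p with P y
      ... | false = none ys p
    ... | true with satisfied (any⁻ P xs (true⇒T found))
    ...   | s₀ , Ps₀ = sym (trans (∑-cong xs is-s₀) (counts-once enum s₀))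
      where
      is-s₀ : ∀ s → 𝟙 (P s) ≡ 𝟙 (does (s ≟ s₀))
      is-s₀ s with P s in Ps | s ≟ s₀
      ... | true  | yes _    = refl
      ... | true  | no s≢s₀  = ⊥-elim (s≢s₀ (unique s s₀ (true⇒T Ps) Ps₀))
      ... | false | yes refl = ⊥-elim (subst T Ps Ps₀)
      ... | false | no _     = refl

  allFin-counts : ∀ n (c : Fin n) → ∑[ i ← allFin n ] 𝟙 (does (i Fin.≟ c)) ≡ 1
  allFin-counts (suc n) c = begin
    ∑[ i ← allFin (suc n) ] 𝟙 (does (i Fin.≟ c))
      ≡⟨ cong (λ is → 𝟙 (does (Fin.zero Fin.≟ c)) + ∑[ i ← is ] 𝟙 (does (i Fin.≟ c)))
              (sym (map-tabulate id Fin.suc)) ⟩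
    𝟙 (does (Fin.zero Fin.≟ c)) + ∑[ i ← map Fin.suc (allFin n) ] 𝟙 (does (i Fin.≟ c))
      ≡⟨ cong (𝟙 (does (Fin.zero Fin.≟ c)) +_) (∑-map (allFin n) Fin.suc _) ⟩
    𝟙 (does (Fin.zero Fin.≟ c)) + ∑[ i ← allFin n ] 𝟙 (does (Fin.suc i Fin.≟ c))
      ≡⟨ split c ⟩
    1 ∎
    where
    open ≡-Reasoning
    split : ∀ c → 𝟙 (does (Fin.zero Fin.≟ c)) + ∑[ i ← allFin n ] 𝟙 (does (Fin.suc i Fin.≟ c)) ≡ 1
    split Fin.zero    = cong suc (∑-zero (allFin n))
    split (Fin.suc c) = allFin-counts n c

  allFin-enumerates : ∀ n → Enumerates Fin._≟_ (allFin n)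
  allFin-enumerates n = counting (allFin-counts n)

  module _ {_≟A_ : DecidableEquality A} {_≟B_ : DecidableEquality B} where

    ↔-enumerates : {xs : List B} (e : B ↔ A) → Enumerates _≟B_ xs → Enumerates _≟A_ (map (Inverse.to e) xs)
    ↔-enumerates {xs} e enum = counting counts
      where
      open Inverse e using (to; from; strictlyInverseˡ; strictlyInverseʳ)
      to≡⇔≡from : ∀ b c → (to b ≡ c) ⇔ (b ≡ from c)
      to≡⇔≡from b c = mk⇔ (λ { refl → sym (strictlyInverseʳ b) }) (λ { refl → strictlyInverseˡ c })
      counts : ∀ c → ∑[ a ← map to xs ] 𝟙 (does (a ≟A c)) ≡ 1
      counts c = begin
        ∑[ a ← map to xs ] 𝟙 (does (a ≟A c)) ≡⟨ ∑-map xs to _ ⟩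
        ∑[ b ← xs ] 𝟙 (does (to b ≟A c))     ≡⟨ ∑-cong xs (λ b → cong 𝟙 (does-⇔ (to≡⇔≡from b c) (to b ≟A c) (b ≟B from c))) ⟩
        ∑[ b ← xs ] 𝟙 (does (b ≟B from c))   ≡⟨ counts-once enum (from c) ⟩
        1                                    ∎
        where open ≡-Reasoning

    ×-enumerates : {xs : List A} {ys : List B} → Enumerates _≟A_ xs → Enumerates _≟B_ ys →
                   Enumerates (≡-dec _≟A_ _≟B_) (cartesianProduct xs ys)
    ×-enumerates {xs} {ys} enumA enumB = counting λ (c , d) → counts c d
      where
      pair-indicator : ∀ a b c d → 𝟙 (does (≡-dec _≟A_ _≟B_ (a , b) (c , d))) ≡ 𝟙 (does (a ≟A c)) * 𝟙 (does (b ≟B d))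
      pair-indicator a b c d =
        trans (cong 𝟙 (does-⇔ componentwise (≡-dec _≟A_ _≟B_ (a , b) (c , d)) (a ≟A c ×-dec b ≟B d)))
              (𝟙-∧ (does (a ≟A c)) (does (b ≟B d)))
        where
        componentwise : ((a , b) ≡ (c , d)) ⇔ ((a ≡ c) × (b ≡ d))
        componentwise = mk⇔ (λ { refl → refl , refl }) (λ { (refl , refl) → refl })
      counts : ∀ c d → ∑[ p ← cartesianProduct xs ys ] 𝟙 (does (≡-dec _≟A_ _≟B_ p (c , d))) ≡ 1
      counts c d = begin
        ∑[ p ← cartesianProduct xs ys ] 𝟙 (does (≡-dec _≟A_ _≟B_ p (c , d)))
          ≡⟨ ∑-cartesian xs ys _ ⟩
        ∑[ a ← xs ] ∑[ b ← ys ] 𝟙 (does (≡-dec _≟A_ _≟B_ (a , b) (c , d)))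
          ≡⟨ ∑-cong xs (λ a → ∑-cong ys (λ b → pair-indicator a b c d)) ⟩
        ∑[ a ← xs ] ∑[ b ← ys ] (𝟙 (does (a ≟A c)) * 𝟙 (does (b ≟B d)))
          ≡⟨ ∑-cong xs (λ a → ∑-*ˡ ys (𝟙 (does (a ≟A c))) _) ⟩
        ∑[ a ← xs ] (𝟙 (does (a ≟A c)) * ∑[ b ← ys ] 𝟙 (does (b ≟B d)))
          ≡⟨ ∑-cong xs (λ a → cong (𝟙 (does (a ≟A c)) *_) (counts-once enumB d)) ⟩
        ∑[ a ← xs ] (𝟙 (does (a ≟A c)) * 1)
          ≡⟨ ∑-cong xs (λ a → *-identityʳ _) ⟩
        ∑[ a ← xs ] 𝟙 (does (a ≟A c))
          ≡⟨ counts-once enumA c ⟩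
        1 ∎
        where open ≡-Reasoning

module NatArithmetic where

  open import Data.Nat
  open import Data.Nat.Properties
  open import Data.Nat.DivMod using (_/_; _%_; m≡m%n+[m/n]*n; m%n<n)
  open import Data.Nat.Tactic.RingSolver using (solve; solve-∀)
  open import Data.List using ([]; _∷_)
  open import Data.Bool using (false; T)
  open import Data.Product using (∃; _,_)
  open import Data.Sum using (_⊎_; inj₁; inj₂)
  open import Relation.Binary.PropositionalEquality
  open import Relation.Nullary using (yes; no; contradiction)

  ≤ᵇ-false : ∀ {a b} → (a ≤ᵇ b) ≡ false → b < a
  ≤ᵇ-false a≰b = ≰⇒> (λ a≤b → subst T a≰b (≤⇒≤ᵇ a≤b))

  Distance : ℕ → ℕ → ℕ → Set
  Distance m n t = m + t ≡ n ⊎ n + t ≡ m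

  distance : ∀ m n → ∃ (Distance m n)
  distance m n with ≤-total m n
  ... | inj₁ m≤n = n ∸ m , inj₁ (m+[n∸m]≡n m≤n)
  ... | inj₂ n≤m = m ∸ n , inj₂ (m+[n∸m]≡n n≤m)

  -- 16 (m² + n²) = 32 m n + 16 (m − n)², the identity behind the
  -- variance argument.
  variance-identity : ∀ {m n t} → Distance m n t → 32 * m * n + 16 * (t * t) ≡ 16 * (m * m + n * n)
  variance-identity {m} {t = t} (inj₁ refl) = solve (m ∷ t ∷ [])
  variance-identity {n = n} {t} (inj₂ refl) = solve (n ∷ t ∷ [])

  am-gm : ∀ m n → 32 * m * n ≤ 16 * (m * m + n * n)
  am-gm m n with distance m n
  ... | t , gap = ≤-trans (m≤m+n (32 * m * n) _) (≤-reflexive (variance-identity gap))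

  far-from-mean : ∀ {m n t} → Distance m n t → m ≤ 4 * t → m * m + 32 * m * n ≤ 16 * (m * m + n * n)
  far-from-mean {m} {n} {t} gap m≤4t = begin
    m * m + 32 * m * n          ≤⟨ +-monoˡ-≤ (32 * m * n) m²≤16t² ⟩
    16 * (t * t) + 32 * m * n   ≡⟨ +-comm (16 * (t * t)) _ ⟩
    32 * m * n + 16 * (t * t)   ≡⟨ variance-identity gap ⟩
    16 * (m * m + n * n)        ∎
    where
    open ≤-Reasoning
    m²≤16t² : m * m ≤ 16 * (t * t)
    m²≤16t² = ≤-trans (*-mono-≤ m≤4t m≤4t) (≤-reflexive (solve (t ∷ [])))

  below-far : ∀ {m n} → 5 * m ≤ 4 * n → m * m + 32 * m * n ≤ 16 * (m * m + n * n)
  below-far {m} {n} 5m≤4n = far-from-mean (inj₁ (m+[n∸m]≡n m≤n)) m≤4t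
    where
    m≤n : m ≤ n
    m≤n = *-cancelˡ-≤ 5 (≤-trans 5m≤4n (*-monoˡ-≤ n (n≤1+n 4)))
    m≤4t : m ≤ 4 * (n ∸ m)
    m≤4t = +-cancelˡ-≤ (4 * m) m (4 * (n ∸ m)) (begin
      4 * m + m           ≡⟨ solve (m ∷ []) ⟩
      5 * m               ≤⟨ 5m≤4n ⟩
      4 * n               ≡⟨ cong (4 *_) (m+[n∸m]≡n m≤n) ⟨
      4 * (m + (n ∸ m))   ≡⟨ *-distribˡ-+ 4 m (n ∸ m) ⟩
      4 * m + 4 * (n ∸ m) ∎)
      where open ≤-Reasoning

  above-far : ∀ {m n} → 2 * n ≤ m → m * m + 32 * m * n ≤ 16 * (m * m + n * n)
  above-far {m} {n} 2n≤m = far-from-mean (inj₂ (m+[n∸m]≡n n≤m)) m≤4t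
    where
    open ≤-Reasoning
    n≤m : n ≤ m
    n≤m = ≤-trans (m≤m+n n (n + 0)) 2n≤m
    n≤t : n ≤ m ∸ n
    n≤t = +-cancelˡ-≤ n n (m ∸ n) (begin
      n + n       ≡⟨ solve (n ∷ []) ⟩
      2 * n       ≤⟨ 2n≤m ⟩
      m           ≡⟨ m+[n∸m]≡n n≤m ⟨
      n + (m ∸ n) ∎)
    m≤4t : m ≤ 4 * (m ∸ n)
    m≤4t = begin
      m                 ≡⟨ m+[n∸m]≡n n≤m ⟨
      n + (m ∸ n)       ≤⟨ +-monoˡ-≤ (m ∸ n) n≤t ⟩
      (m ∸ n) + (m ∸ n) ≤⟨ twice≤4× (m ∸ n) ⟩
      4 * (m ∸ n)       ∎
      where
      twice≤4× : ∀ t → t + t ≤ 4 * t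
      twice≤4× t = ≤-trans (m≤m+n (t + t) (t + t)) (≤-reflexive (quadruple t))
        where
        quadruple : ∀ t → t + t + (t + t) ≡ 4 * t
        quadruple = solve-∀

  -- A line meeting E in k points, with k outside the window
  -- 2 ≤ k, 2q + n ≤ 2qk, qk ≤ 2n, has m = qk far from the mean n
  -- (provided n ≥ 4q).
  outside-window : ∀ q n k → 4 * q ≤ n → k < 2 ⊎ 2 * q * k < 2 * q + n ⊎ 2 * n < q * k →
                   5 * (q * k) ≤ 4 * n ⊎ 2 * n ≤ q * k
  outside-window q n k 4q≤n (inj₁ k<2) = inj₁ (begin
    5 * (q * k)         ≤⟨ *-monoʳ-≤ 5 (*-monoʳ-≤ q (≤-pred k<2)) ⟩
    5 * (q * 1)         ≤⟨ m≤m+n _ (11 * q) ⟩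
    5 * (q * 1) + 11 * q ≡⟨ solve (q ∷ []) ⟩
    4 * (4 * q)         ≤⟨ *-monoʳ-≤ 4 4q≤n ⟩
    4 * n               ∎)
    where open ≤-Reasoning
  outside-window q n k 4q≤n (inj₂ (inj₁ 2qk<2q+n)) = inj₁ (*-cancelˡ-≤ 2 (<⇒≤ (begin-strict
    2 * (5 * (q * k))   ≡⟨ solve (q ∷ k ∷ []) ⟩
    5 * (2 * q * k)     <⟨ *-monoʳ-< 5 2qk<2q+n ⟩
    5 * (2 * q + n)     ≤⟨ m≤m+n _ (2 * q) ⟩
    5 * (2 * q + n) + 2 * q ≡⟨ solve (q ∷ n ∷ []) ⟩
    3 * (4 * q) + 5 * n ≤⟨ +-monoˡ-≤ (5 * n) (*-monoʳ-≤ 3 4q≤n) ⟩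
    3 * n + 5 * n       ≡⟨ solve (n ∷ []) ⟩
    2 * (4 * n)         ∎)))
    where open ≤-Reasoning
  outside-window q n k 4q≤n (inj₂ (inj₂ 2n<qk)) = inj₂ (<⇒≤ 2n<qk)

  far-line : ∀ q n k → 4 * q ≤ n → k < 2 ⊎ 2 * q * k < 2 * q + n ⊎ 2 * n < q * k →
             (q * k) * (q * k) + 32 * (q * k) * n ≤ 16 * ((q * k) * (q * k) + n * n)
  far-line q n k 4q≤n outside with outside-window q n k 4q≤n outside
  ... | inj₁ below = below-far {q * k} {n} below
  ... | inj₂ above = above-far {q * k} {n} above

  -- The summed variance inequality (see Incidences), divided by q³: the
  -- mass B of the badly-sized lines is at most 16 q n.
  bad-mass-bound : ∀ q n B → {{NonZero q}} →
    q * q * (q * B) + 32 * q * n * (q * (n * suc q)) ≤ 16 * (q * q * (q * (n * (n + q))) + n * n * (suc q * (q * q))) →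
    B ≤ 16 * q * n
  bad-mass-bound q n B {{q≢0}} variance = *-cancelˡ-≤ (q * (q * q)) {{m*n≢0 q (q * q) {{q≢0}} {{m*n≢0 q q}}}}
    (+-cancelʳ-≤ rest (q * (q * q) * B) (q * (q * q) * (16 * q * n)) (begin
      q * (q * q) * B + rest                            ≤⟨ m≤m+n _ (16 * (q * q * (n * n))) ⟩
      q * (q * q) * B + rest + 16 * (q * q * (n * n))   ≡⟨ expand-lhs q n B ⟩
      q * q * (q * B) + 32 * q * n * (q * (n * suc q))  ≤⟨ variance ⟩
      16 * (q * q * (q * (n * (n + q))) + n * n * (suc q * (q * q))) ≡⟨ expand-rhs q n ⟩
      q * (q * q) * (16 * q * n) + rest                 ∎))
    where
    open ≤-Reasoning
    rest : ℕ
    rest = 32 * (q * (q * q) * (n * n)) + 16 * (q * q * (n * n))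
    expand-lhs : ∀ q n B → q * (q * q) * B + (32 * (q * (q * q) * (n * n)) + 16 * (q * q * (n * n))) + 16 * (q * q * (n * n))
                           ≡ q * q * (q * B) + 32 * q * n * (q * (n * suc q))
    expand-lhs = solve-∀
    expand-rhs : ∀ q n → 16 * (q * q * (q * (n * (n + q))) + n * n * (suc q * (q * q)))
                         ≡ q * (q * q) * (16 * q * n) + (32 * (q * (q * q) * (n * n)) + 16 * (q * q * (n * n)))
    expand-rhs = solve-∀

  pair-count-bound : ∀ q n G → 1 ≤ q → 40 * q ≤ n → n * n ≤ G + n + 16 * q * n → n * n ≤ 4 * (G / 2)
  pair-count-bound q n G 1≤q 40q≤n n²≤ = +-cancelʳ-≤ 2 (n * n) (4 * (G / 2)) (begin
    n * n + 2       ≤⟨ n²+2≤2G ⟩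
    2 * G           ≤⟨ twice≤4half ⟩
    4 * (G / 2) + 2 ∎)
    where
    open ≤-Reasoning
    n≤qn : n ≤ q * n
    n≤qn = ≤-trans (≤-reflexive (sym (*-identityˡ n))) (*-monoˡ-≤ n 1≤q)
    2≤n : 2 ≤ n
    2≤n = ≤-trans (m≤m+n 2 38) (≤-trans (*-monoʳ-≤ 40 1≤q) 40q≤n)
    small-terms : 32 * q * n + 2 * n + 2 ≤ n * n
    small-terms = begin
      32 * q * n + 2 * n + 2   ≤⟨ +-monoʳ-≤ (32 * q * n + 2 * n) 2≤n ⟩
      32 * q * n + 2 * n + n   ≡⟨ solve (q ∷ n ∷ []) ⟩
      32 * q * n + 3 * n       ≤⟨ +-monoʳ-≤ (32 * q * n) (*-monoʳ-≤ 3 n≤qn) ⟩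
      32 * q * n + 3 * (q * n) ≤⟨ m≤m+n _ (5 * (q * n)) ⟩
      32 * q * n + 3 * (q * n) + 5 * (q * n) ≡⟨ solve (q ∷ n ∷ []) ⟩
      40 * q * n               ≤⟨ *-monoˡ-≤ n 40q≤n ⟩
      n * n                    ∎
    n²+2≤2G : n * n + 2 ≤ 2 * G
    n²+2≤2G = +-cancelʳ-≤ (2 * n + 32 * q * n) (n * n + 2) (2 * G) (begin
      n * n + 2 + (2 * n + 32 * q * n)        ≡⟨ solve (n ∷ q ∷ []) ⟩
      n * n + (32 * q * n + 2 * n + 2)        ≤⟨ +-monoʳ-≤ (n * n) small-terms ⟩
      n * n + n * n                           ≤⟨ +-mono-≤ n²≤ n²≤ ⟩
      (G + n + 16 * q * n) + (G + n + 16 * q * n) ≡⟨ solve (G ∷ n ∷ q ∷ []) ⟩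
      2 * G + (2 * n + 32 * q * n)            ∎)
    twice≤4half : 2 * G ≤ 4 * (G / 2) + 2
    twice≤4half = begin
      2 * G                       ≡⟨ cong (2 *_) (m≡m%n+[m/n]*n G 2) ⟩
      2 * (G % 2 + G / 2 * 2)     ≤⟨ *-monoʳ-≤ 2 (+-monoˡ-≤ (G / 2 * 2) (≤-pred (m%n<n G 2))) ⟩
      2 * (1 + G / 2 * 2)         ≡⟨ regroup (G / 2) ⟩
      4 * (G / 2) + 2             ∎
      where
      regroup : ∀ h → 2 * (1 + h * 2) ≡ 4 * h + 2
      regroup = solve-∀

  -- q^(64 q) ≤ 2^n, i.e. n ≥ 64 q log₂ q, gives n ≥ 640 q once q ≥ 2¹⁰.
  log-bound : ∀ q n → 1024 ≤ q → q ^ (64 * q) ≤ 2 ^ n → 640 * q ≤ n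
  log-bound q n 1024≤q q^64q≤2^n with 640 * q ≤? n
  ... | yes 640q≤n = 640q≤n
  ... | no  640q≰n = contradiction 2^640q≤2^n (<⇒≱ (^-monoʳ-< 2 (s≤s (s≤s z≤n)) (≰⇒> 640q≰n)))
    where
    open ≤-Reasoning
    2^640q≤2^n : 2 ^ (640 * q) ≤ 2 ^ n
    2^640q≤2^n = begin
      2 ^ (640 * q)       ≡⟨ cong (2 ^_) (*-assoc 10 64 q) ⟩
      2 ^ (10 * (64 * q)) ≡⟨ ^-*-assoc 2 10 (64 * q) ⟨
      1024 ^ (64 * q)     ≤⟨ ^-monoˡ-≤ (64 * q) 1024≤q ⟩
      q ^ (64 * q)        ≤⟨ q^64q≤2^n ⟩
      2 ^ n               ∎

module PlaneGeometry (F : FiniteField) where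

  open FiniteSums
  open Enumerations
  open Decisions
  open import Data.Nat using (ℕ; suc; _*_) renaming (_+_ to _+ℕ_)
  import Data.Nat.Properties as ℕ
  open import Data.Bool using (T)
  open import Data.Empty using (⊥-elim)
  open import Data.List using (List; _∷_; map; length; allFin)
  import Data.List.Properties as List
  open import Data.List.Membership.Propositional using (_∈_)
  open import Data.List.Membership.Propositional.Properties using (∈-map⁻)
  open import Data.List.Relation.Unary.Any using (here; there; satisfied)
  open import Data.List.Relation.Unary.Any.Properties using (any⁻)
  open import Data.Product using (∃; _,_; proj₁; proj₂)
  open import Data.Sum using (_⊎_; inj₁; inj₂)
  open import Relation.Nullary using (Dec; does; yes; no)
  open import Relation.Nullary.Decidable using (does-⇔)
  open import Relation.Binary.PropositionalEquality
  open import Function using (_∘_; id; mk⇔)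
  open import Algebra.Bundles using (CommutativeRing)
  import Algebra.Properties.Group as GroupProperties
  import Algebra.Properties.Ring as RingProperties

  open FiniteField F renaming (_+F_ to infixl 6 _+_; _*F_ to infixl 7 _·_; -F_ to -_; _≟_ to infix 4 _≟_)
  open import Algebra.Structures using (IsCommutativeRing)
  open IsCommutativeRing isCommutativeRing
    using (+-assoc; +-comm; *-assoc; *-comm; distribʳ; zeroˡ; zeroʳ; +-identityʳ; *-identityˡ; *-identityʳ)

  private
    ring : CommutativeRing _ _
    ring = record { isCommutativeRing = isCommutativeRing }

  open GroupProperties (CommutativeRing.+-group ring) using (x≈z//y; //-rightDividesˡ; ∙-cancelˡ)
  open RingProperties (CommutativeRing.ring ring) using (-‿distribˡ-*)

  infixl 6 _⊕_ _⊖_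
  infixr 7 _⊙_
  _⊕_ : Pt F → Pt F → Pt F
  _⊕_ = _+ₚ_ F
  _⊖_ : Pt F → Pt F → Pt F
  _⊖_ = _-ₚ_ F
  _⊙_ : Carrier → Pt F → Pt F
  _⊙_ = _·ₚ_ F

  elems-enumerates : Enumerates _≟_ (elems F)
  elems-enumerates = ↔-enumerates enum (allFin-enumerates size)

  points-enumerates : Enumerates (_≟ₚ_ F) (points F)
  points-enumerates = ×-enumerates elems-enumerates elems-enumerates

  length-elems : length (elems F) ≡ size
  length-elems = trans (List.length-map _ (allFin size)) (List.length-tabulate id)

  ⊕⇒⊖ : ∀ {x p w} → x ≡ p ⊕ w → p ≡ x ⊖ w
  ⊕⇒⊖ x≡p⊕w = cong₂ _,_ (x≈z//y _ _ _ (sym (cong proj₁ x≡p⊕w))) (x≈z//y _ _ _ (sym (cong proj₂ x≡p⊕w)))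

  ⊖⇒⊕ : ∀ {x p w} → p ≡ x ⊖ w → x ≡ p ⊕ w
  ⊖⇒⊕ {x} {w = w} refl =
    cong₂ _,_ (sym (//-rightDividesˡ (proj₁ w) (proj₁ x))) (sym (//-rightDividesˡ (proj₂ w) (proj₂ x)))

  difference : ∀ {x e w} → x ≡ e ⊕ w → x ⊖ e ≡ w
  difference {x} {e} {w} x≡e⊕w = sym (⊕⇒⊖ (trans x≡e⊕w (cong₂ _,_ (+-comm _ _) (+-comm _ _))))

  difference⁻¹ : ∀ {x e w} → x ⊖ e ≡ w → x ≡ e ⊕ w
  difference⁻¹ {x} {e} {w} refl = trans (⊖⇒⊕ refl) (cong₂ _,_ (+-comm _ _) (+-comm _ _))

  ⊕-cancelˡ : ∀ {p u v} → p ⊕ u ≡ p ⊕ v → u ≡ v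
  ⊕-cancelˡ eq = cong₂ _,_ (∙-cancelˡ _ _ _ (cong proj₁ eq)) (∙-cancelˡ _ _ _ (cong proj₂ eq))

  ⊙-assoc : ∀ s t d → s ⊙ t ⊙ d ≡ (s · t) ⊙ d
  ⊙-assoc s t d = cong₂ _,_ (sym (*-assoc s t _)) (sym (*-assoc s t _))

  ⊙-zero : ∀ p d → p ⊕ 0# ⊙ d ≡ p
  ⊙-zero p d = cong₂ _,_ (trans (cong (_ +_) (zeroˡ _)) (+-identityʳ _)) (trans (cong (_ +_) (zeroˡ _)) (+-identityʳ _))

  ⊙-distrib : ∀ p s t d → p ⊕ s ⊙ d ⊕ t ⊙ d ≡ p ⊕ (s + t) ⊙ d
  ⊙-distrib p s t d = cong₂ _,_ (step (proj₁ p) (proj₁ d)) (step (proj₂ p) (proj₂ d))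
    where
    step : ∀ a b → a + s · b + t · b ≡ a + (s + t) · b
    step a b = trans (+-assoc a _ _) (cong (a +_) (sym (distribʳ b s t)))

  ⊙-neg : ∀ x s d → x ⊖ s ⊙ d ≡ x ⊕ (- s) ⊙ d
  ⊙-neg x s d = cong₂ _,_ (cong (_ +_) (-‿distribˡ-* s _)) (cong (_ +_) (-‿distribˡ-* s _))

  on-line-sound : ∀ {a d x} → T (onLine F a d x) → ∃ λ s → x ≡ a ⊕ s ⊙ d
  on-line-sound {a} {d} {x} on with satisfied (any⁻ (λ t → does (_≟ₚ_ F x (a ⊕ t ⊙ d))) (elems F) on)
  ... | s , found = s , does-sound (_≟ₚ_ F x (a ⊕ s ⊙ d)) found

  on-line-complete : ∀ {a d x} s → x ≡ a ⊕ s ⊙ d → T (onLine F a d x)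
  on-line-complete {a} {d} {x} s x≡ = any-intro elems-enumerates (λ t → does (_≟ₚ_ F x (a ⊕ t ⊙ d))) s (does-complete (_≟ₚ_ F x (a ⊕ s ⊙ d)) x≡)

  base-on-line : ∀ a d → T (onLine F a d a)
  base-on-line a d = on-line-complete 0# (sym (⊙-zero a d))

  on-line-trans : ∀ {p x y d} → T (onLine F p d x) → T (onLine F x d y) → T (onLine F p d y)
  on-line-trans {p} {x} {y} {d} p→x x→y with on-line-sound p→x | on-line-sound x→y
  ... | s , x≡ | t , y≡ = on-line-complete (s + t) (trans y≡ (trans (cong (_⊕ t ⊙ d) x≡) (⊙-distrib p s t d)))

  on-line-sym : ∀ {p x d} → T (onLine F p d x) → T (onLine F x d p)
  on-line-sym {p} {x} {d} p→x with on-line-sound p→x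
  ... | s , x≡ = on-line-complete (- s) (trans (⊕⇒⊖ x≡) (⊙-neg x s d))

  same-line-from : ∀ {p x d} → T (onLine F p d x) → ∀ y → onLine F x d y ≡ onLine F p d y
  same-line-from p→x y = T-injective (on-line-trans p→x) (on-line-trans (on-line-sym p→x))

  rescaled-line : ∀ {e d c} → c ≢ 0# → ∀ y → onLine F e (c ⊙ d) y ≡ onLine F e d y
  rescaled-line {e} {d} {c} c≢0 y with inv c c≢0
  ... | u , cu≡1 = T-injective shrink stretch
    where
    shrink : T (onLine F e (c ⊙ d) y) → T (onLine F e d y)
    shrink on with on-line-sound on
    ... | s , y≡ = on-line-complete (s · c) (trans y≡ (cong (e ⊕_) (⊙-assoc s c d)))
    su·c≡s : ∀ s → s · u · c ≡ s
    su·c≡s s = trans (*-assoc s u c) (trans (cong (s ·_) (trans (*-comm u c) cu≡1)) (*-identityʳ s))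
    stretch : T (onLine F e d y) → T (onLine F e (c ⊙ d) y)
    stretch on with on-line-sound on
    ... | s , y≡ = on-line-complete (s · u) (begin
      y                       ≡⟨ y≡ ⟩
      e ⊕ s ⊙ d               ≡⟨ cong (λ r → e ⊕ r ⊙ d) (su·c≡s s) ⟨
      e ⊕ (s · u · c) ⊙ d     ≡⟨ cong (e ⊕_) (⊙-assoc (s · u) c d) ⟨
      e ⊕ (s · u) ⊙ (c ⊙ d)   ∎)
      where open ≡-Reasoning

  line-through : ∀ {e d x} → T (onLine F e d x) → x ≢ e → ∀ y → onLine F e (x ⊖ e) y ≡ onLine F e d y
  line-through {e} {d} {x} e→x x≢e y with on-line-sound e→x
  ... | s , x≡ = trans (cong (λ v → onLine F e v y) (difference x≡)) (rescaled-line s≢0 y)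
    where
    s≢0 : s ≢ 0#
    s≢0 refl = x≢e (trans x≡ (⊙-zero e d))

  Normalised : Pt F → Set
  Normalised d = proj₁ d ≡ 1# ⊎ proj₂ d ≡ 1#

  parameter-unique : ∀ {a d s t} → Normalised d → a ⊕ s ⊙ d ≡ a ⊕ t ⊙ d → s ≡ t
  parameter-unique {d = d} {s} {t} normal eq = by-coordinate normal (⊕-cancelˡ eq)
    where
    cancel-unit : ∀ {b} → b ≡ 1# → s · b ≡ t · b → s ≡ t
    cancel-unit refl sb≡tb = trans (sym (*-identityʳ s)) (trans sb≡tb (*-identityʳ t))
    by-coordinate : Normalised d → s ⊙ d ≡ t ⊙ d → s ≡ t
    by-coordinate (inj₁ d₁≡1) sd≡td = cancel-unit d₁≡1 (cong proj₁ sd≡td)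
    by-coordinate (inj₂ d₂≡1) sd≡td = cancel-unit d₂≡1 (cong proj₂ sd≡td)

  -- Every point x lies on exactly q of the "based lines" (p , d) with a
  -- fixed normalised direction d: one base point p = x - s d for each s.
  basepoint-count : ∀ {d} → Normalised d → ∀ x → ∑[ p ← points F ] 𝟙 (onLine F p d x) ≡ size
  basepoint-count {d} normal x = begin
    ∑[ p ← points F ] 𝟙 (onLine F p d x)
      ≡⟨ ∑-cong (points F) (λ p → 𝟙-any elems-enumerates _ (unique p)) ⟩
    ∑[ p ← points F ] ∑[ s ← elems F ] 𝟙 (does (_≟ₚ_ F x (p ⊕ s ⊙ d)))
      ≡⟨ ∑-cong (points F) (λ p → ∑-cong (elems F) (λ s → cong 𝟙 (solve-for-base p s))) ⟩
    ∑[ p ← points F ] ∑[ s ← elems F ] 𝟙 (does (_≟ₚ_ F p (x ⊖ s ⊙ d)))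
      ≡⟨ ∑-swap (points F) (elems F) _ ⟩
    ∑[ s ← elems F ] ∑[ p ← points F ] 𝟙 (does (_≟ₚ_ F p (x ⊖ s ⊙ d)))
      ≡⟨ ∑-cong (elems F) (λ s → counts-once points-enumerates (x ⊖ s ⊙ d)) ⟩
    ∑[ s ← elems F ] 1
      ≡⟨ trans (∑-const (elems F) 1) (ℕ.*-identityʳ _) ⟩
    length (elems F)
      ≡⟨ length-elems ⟩
    size ∎
    where
    open ≡-Reasoning
    unique : ∀ p s t → T (does (_≟ₚ_ F x (p ⊕ s ⊙ d))) → T (does (_≟ₚ_ F x (p ⊕ t ⊙ d))) → s ≡ t
    unique p s t xs xt = parameter-unique normal
      (trans (sym (does-sound (_≟ₚ_ F x _) xs)) (does-sound (_≟ₚ_ F x _) xt))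
    solve-for-base : ∀ p s → does (_≟ₚ_ F x (p ⊕ s ⊙ d)) ≡ does (_≟ₚ_ F p (x ⊖ s ⊙ d))
    solve-for-base p s = does-⇔ (mk⇔ ⊕⇒⊖ ⊖⇒⊕) (_≟ₚ_ F x (p ⊕ s ⊙ d)) (_≟ₚ_ F p (x ⊖ s ⊙ d))

  directions : List (Pt F)
  directions = (0# , 1#) ∷ map (1# ,_) (elems F)

  directions-normalised : ∀ {d} → d ∈ directions → Normalised d
  directions-normalised (here refl) = inj₂ refl
  directions-normalised (there d∈) with ∈-map⁻ (1# ,_) d∈
  ... | t , _ , refl = inj₁ refl

  length-directions : length directions ≡ suc size
  length-directions = cong suc (trans (List.length-map _ (elems F)) length-elems)

  -- Through e and any other point x passes exactly one line with a
  -- direction from 'directions': the one spanned by a rescaling of x - e.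
  one-direction : ∀ {e x} → x ≢ e → ∑[ d ← directions ] 𝟙 (onLine F e d x) ≡ 1
  one-direction {e} {x} x≢e = begin
    ∑[ d ← directions ] 𝟙 (onLine F e d x)
      ≡⟨ cong₂ _+ℕ_ (cong 𝟙 vertical) (trans (∑-map (elems F) (1# ,_) _) (∑-cong (elems F) (cong 𝟙 ∘ slope))) ⟩
    𝟙 (does (v₁ ≟ 0#)) +ℕ ∑[ t ← elems F ] 𝟙 (does (v₂ ≟ v₁ · t))
      ≡⟨ count (v₁ ≟ 0#) ⟩
    1 ∎
    where
    open ≡-Reasoning
    v₁ v₂ : Carrier
    v₁ = proj₁ (x ⊖ e)
    v₂ = proj₂ (x ⊖ e)
    spanned : ∀ {d} s → x ⊖ e ≡ s ⊙ d → T (onLine F e d x)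
    spanned s v≡ = on-line-complete s (difference⁻¹ v≡)
    spanning : ∀ {d} → T (onLine F e d x) → ∃ λ s → x ⊖ e ≡ s ⊙ d
    spanning on with on-line-sound on
    ... | s , x≡ = s , difference x≡
    vertical : onLine F e (0# , 1#) x ≡ does (v₁ ≟ 0#)
    vertical = T-injective
      (λ on → let s , v≡ = spanning on in does-complete (v₁ ≟ 0#) (trans (cong proj₁ v≡) (zeroʳ s)))
      (λ v₁≡0 → spanned v₂ (cong₂ _,_ (trans (does-sound (v₁ ≟ 0#) v₁≡0) (sym (zeroʳ v₂))) (sym (*-identityʳ v₂))))
    slope : ∀ t → onLine F e (1# , t) x ≡ does (v₂ ≟ v₁ · t)
    slope t = T-injective
      (λ on → let s , v≡ = spanning on in
        does-complete (v₂ ≟ v₁ · t) (trans (cong proj₂ v≡) (cong (_· t) (sym (trans (cong proj₁ v≡) (*-identityʳ s))))))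
      (λ v₂≡ → spanned v₁ (cong₂ _,_ (sym (*-identityʳ v₁)) (does-sound (v₂ ≟ v₁ · t) v₂≡)))
    count : (v₁≟0 : Dec (v₁ ≡ 0#)) → 𝟙 (does v₁≟0) +ℕ ∑[ t ← elems F ] 𝟙 (does (v₂ ≟ v₁ · t)) ≡ 1
    count (yes v₁≡0) = cong suc (trans (∑-cong (elems F) no-slope) (∑-zero (elems F)))
      where
      no-slope : ∀ t → 𝟙 (does (v₂ ≟ v₁ · t)) ≡ 0
      no-slope t with v₂ ≟ v₁ · t
      ... | no _ = refl
      ... | yes v₂≡ = ⊥-elim (x≢e (trans (difference⁻¹ {w = 0# , 0#} (cong₂ _,_ v₁≡0 v₂≡0)) (cong₂ _,_ (+-identityʳ _) (+-identityʳ _))))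
        where v₂≡0 = trans v₂≡ (trans (cong (_· t) v₁≡0) (zeroˡ t))
    count (no v₁≢0) with inv v₁ v₁≢0
    ... | u , v₁u≡1 = trans (∑-cong (elems F) (cong 𝟙 ∘ solve-for-slope)) (counts-once elems-enumerates (u · v₂))
      where
      solve-for-slope : ∀ t → does (v₂ ≟ v₁ · t) ≡ does (t ≟ u · v₂)
      solve-for-slope t = does-⇔ (mk⇔ divide multiply) (v₂ ≟ v₁ · t) (t ≟ u · v₂)
        where
        divide : v₂ ≡ v₁ · t → t ≡ u · v₂
        divide v₂≡ = sym (begin
          u · v₂       ≡⟨ cong (u ·_) v₂≡ ⟩
          u · (v₁ · t) ≡⟨ *-assoc u v₁ t ⟨
          u · v₁ · t   ≡⟨ cong (_· t) (trans (*-comm u v₁) v₁u≡1) ⟩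
          1# · t       ≡⟨ *-identityˡ t ⟩
          t            ∎)
        multiply : t ≡ u · v₂ → v₂ ≡ v₁ · t
        multiply t≡ = sym (begin
          v₁ · t        ≡⟨ cong (v₁ ·_) t≡ ⟩
          v₁ · (u · v₂) ≡⟨ *-assoc v₁ u v₂ ⟨
          v₁ · u · v₂   ≡⟨ cong (_· v₂) v₁u≡1 ⟩
          1# · v₂       ≡⟨ *-identityˡ v₂ ⟩
          v₂            ∎)

  points-count : ∑[ p ← points F ] 1 ≡ size * size
  points-count = begin
    ∑[ p ← points F ] 1                   ≡⟨ ∑-cartesian (elems F) (elems F) (λ _ → 1) ⟩
    ∑[ a ← elems F ] ∑[ b ← elems F ] 1   ≡⟨ ∑-cong (elems F) (λ _ → row) ⟩
    ∑[ a ← elems F ] size                 ≡⟨ ∑-const (elems F) size ⟩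
    length (elems F) * size               ≡⟨ cong (_* size) length-elems ⟩
    size * size                           ∎
    where
    open ≡-Reasoning
    row : ∑[ b ← elems F ] 1 ≡ size
    row = trans (∑-const (elems F) 1) (trans (ℕ.*-identityʳ _) length-elems)

module Incidences (F : FiniteField) (E : Pt F → Bool) where

  open FiniteSums
  open Decisions
  open NatArithmetic
  open Enumerations
  open PlaneGeometry F
  open import Data.Nat using (ℕ; suc; _+_; _*_; _≤_; _<_; _≤ᵇ_; z≤n)
  open import Data.Nat.Properties
  open import Data.Nat.Tactic.RingSolver using (solve-∀)
  open import Data.Bool using (Bool; true; false; T; _∧_; not)
  open import Data.List using (length; cartesianProduct)
  open import Data.Product using (_×_; _,_)
  open import Data.Empty using (⊥-elim)
  open import Data.Sum using (_⊎_; inj₁; inj₂)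
  open import Relation.Nullary using (does; yes; no)
  open import Relation.Binary.PropositionalEquality
  open import Function using (_∘_; flip)

  open FiniteField F using (size)

  q n : ℕ
  q = size
  n = card F E

  lineSize : Pt F → Pt F → ℕ
  lineSize = lineCount F E

  card-as-sum : n ≡ ∑[ x ← points F ] 𝟙 (E x)
  card-as-sum = length-filter E (points F)

  lineSize-as-sum : ∀ p d → lineSize p d ≡ ∑[ x ← points F ] (𝟙 (E x) * 𝟙 (onLine F p d x))
  lineSize-as-sum p d = trans (length-filter _ (points F)) (∑-cong (points F) (λ x → 𝟙-∧ (E x) (onLine F p d x)))

  lineSize-cong : ∀ {p d p′ d′} → (∀ y → onLine F p d y ≡ onLine F p′ d′ y) → lineSize p d ≡ lineSize p′ d′
  lineSize-cong {p} {d} {p′} {d′} same = begin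
    lineSize p d                                              ≡⟨ lineSize-as-sum p d ⟩
    ∑[ y ← points F ] (𝟙 (E y) * 𝟙 (onLine F p d y))          ≡⟨ ∑-cong (points F) (λ y → cong (λ b → 𝟙 (E y) * 𝟙 b) (same y)) ⟩
    ∑[ y ← points F ] (𝟙 (E y) * 𝟙 (onLine F p′ d′ y))        ≡⟨ lineSize-as-sum p′ d′ ⟨
    lineSize p′ d′                                            ∎
    where open ≡-Reasoning

  -- Double counting the incidences (x , ℓ) with x ∈ E ∩ ℓ, ℓ of direction d,
  -- weighted by h(|ℓ ∩ E|).  Each line is represented by the q based lines
  -- (p , d) with p ∈ ℓ.
  incidences-in-direction : ∀ {d} → Normalised d → (h : ℕ → ℕ) →
    ∑[ p ← points F ] (lineSize p d * h (lineSize p d)) ≡ q * ∑[ x ← points F ] (𝟙 (E x) * h (lineSize x d))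
  incidences-in-direction {d} normal h = begin
    ∑[ p ← points F ] (lineSize p d * h (lineSize p d))
      ≡⟨ ∑-cong (points F) expand ⟩
    ∑[ p ← points F ] ∑[ x ← points F ] (𝟙 (E x) * on p x * h (lineSize p d))
      ≡⟨ ∑-cong (points F) (λ p → ∑-cong (points F) (move-weight p)) ⟩
    ∑[ p ← points F ] ∑[ x ← points F ] (weight x * on p x)
      ≡⟨ ∑-swap (points F) (points F) _ ⟩
    ∑[ x ← points F ] ∑[ p ← points F ] (weight x * on p x)
      ≡⟨ ∑-cong (points F) (λ x → trans (∑-*ˡ (points F) (weight x) (λ p → on p x))
                                        (cong (weight x *_) (basepoint-count normal x))) ⟩
    ∑[ x ← points F ] (weight x * q)
      ≡⟨ trans (∑-*ʳ (points F) q weight) (*-comm _ q) ⟩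
    q * ∑[ x ← points F ] weight x ∎
    where
    open ≡-Reasoning
    on : Pt F → Pt F → ℕ
    on p x = 𝟙 (onLine F p d x)
    weight : Pt F → ℕ
    weight x = 𝟙 (E x) * h (lineSize x d)
    expand : ∀ p → lineSize p d * h (lineSize p d) ≡ ∑[ x ← points F ] (𝟙 (E x) * on p x * h (lineSize p d))
    expand p = trans (cong (_* h (lineSize p d)) (lineSize-as-sum p d))
                     (sym (∑-*ʳ (points F) (h (lineSize p d)) (λ x → 𝟙 (E x) * on p x)))
    -- on the line (p , d), the weight may be read off at any of its points x
    move-weight : ∀ p x → 𝟙 (E x) * on p x * h (lineSize p d) ≡ weight x * on p x
    move-weight p x with onLine F p d x in p→x
    ... | false = trans (cong (_* h (lineSize p d)) (*-zeroʳ (𝟙 (E x)))) (sym (*-zeroʳ (weight x)))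
    ... | true  = begin
      𝟙 (E x) * 1 * h (lineSize p d) ≡⟨ cong (λ k → 𝟙 (E x) * 1 * h k) (lineSize-cong (same-line-from (true⇒T p→x))) ⟨
      𝟙 (E x) * 1 * h (lineSize x d) ≡⟨ swap-unit (𝟙 (E x)) (h (lineSize x d)) ⟩
      𝟙 (E x) * h (lineSize x d) * 1 ∎
      where
      swap-unit : ∀ a b → a * 1 * b ≡ a * b * 1
      swap-unit = solve-∀

  incidences : (h : ℕ → ℕ) →
    ∑[ d ← directions ] ∑[ p ← points F ] (lineSize p d * h (lineSize p d))
      ≡ q * ∑[ x ← points F ] (𝟙 (E x) * ∑[ d ← directions ] h (lineSize x d))
  incidences h = begin
    ∑[ d ← directions ] ∑[ p ← points F ] (lineSize p d * h (lineSize p d))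
      ≡⟨ ∑-cong-∈ directions (λ d∈ → incidences-in-direction (directions-normalised d∈) h) ⟩
    ∑[ d ← directions ] (q * ∑[ x ← points F ] (𝟙 (E x) * h (lineSize x d)))
      ≡⟨ ∑-*ˡ directions q _ ⟩
    q * ∑[ d ← directions ] ∑[ x ← points F ] (𝟙 (E x) * h (lineSize x d))
      ≡⟨ cong (q *_) (∑-swap directions (points F) _) ⟩
    q * ∑[ x ← points F ] ∑[ d ← directions ] (𝟙 (E x) * h (lineSize x d))
      ≡⟨ cong (q *_) (∑-cong (points F) (λ x → ∑-*ˡ directions (𝟙 (E x)) _)) ⟩
    q * ∑[ x ← points F ] (𝟙 (E x) * ∑[ d ← directions ] h (lineSize x d)) ∎
    where open ≡-Reasoning

  lines-through : ∀ e x → ∑[ d ← directions ] 𝟙 (onLine F e d x) ≡ 1 + q * 𝟙 (does (_≟ₚ_ F x e))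
  lines-through e x with _≟ₚ_ F x e
  ... | no x≢e   = trans (one-direction x≢e) (cong suc (sym (*-zeroʳ q)))
  ... | yes refl = begin
    ∑[ d ← directions ] 𝟙 (onLine F x d x) ≡⟨ ∑-cong directions (λ d → 𝟙-T (base-on-line x d)) ⟩
    ∑[ d ← directions ] 1                  ≡⟨ ∑-const directions 1 ⟩
    length directions * 1                  ≡⟨ trans (*-identityʳ _) length-directions ⟩
    1 + q                                  ≡⟨ cong suc (*-identityʳ q) ⟨
    1 + q * 1                              ∎
    where open ≡-Reasoning

  -- For e ∈ E the lines through e cover E once, and e itself q + 1 times.
  pencil-sum : ∀ {e} → T (E e) → ∑[ d ← directions ] lineSize e d ≡ n + q
  pencil-sum {e} e∈E = begin
    ∑[ d ← directions ] lineSize e d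
      ≡⟨ ∑-cong directions (lineSize-as-sum e) ⟩
    ∑[ d ← directions ] ∑[ x ← points F ] (𝟙 (E x) * 𝟙 (onLine F e d x))
      ≡⟨ ∑-swap directions (points F) _ ⟩
    ∑[ x ← points F ] ∑[ d ← directions ] (𝟙 (E x) * 𝟙 (onLine F e d x))
      ≡⟨ ∑-cong (points F) (λ x → trans (∑-*ˡ directions (𝟙 (E x)) (λ d → 𝟙 (onLine F e d x)))
                                       (cong (𝟙 (E x) *_) (lines-through e x))) ⟩
    ∑[ x ← points F ] (𝟙 (E x) * (1 + q * 𝟙 (does (_≟ₚ_ F x e))))
      ≡⟨ ∑-cong (points F) (λ x → distribute (𝟙 (E x)) q (𝟙 (does (_≟ₚ_ F x e)))) ⟩
    ∑[ x ← points F ] (𝟙 (E x) + q * (𝟙 (does (_≟ₚ_ F x e)) * 𝟙 (E x)))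
      ≡⟨ ∑-+ (points F) _ _ ⟩
    ∑[ x ← points F ] 𝟙 (E x) + ∑[ x ← points F ] (q * (𝟙 (does (_≟ₚ_ F x e)) * 𝟙 (E x)))
      ≡⟨ cong₂ _+_ (sym card-as-sum) (∑-*ˡ (points F) q _) ⟩
    n + q * ∑[ x ← points F ] (𝟙 (does (_≟ₚ_ F x e)) * 𝟙 (E x))
      ≡⟨ cong (λ c → n + q * c) (trans (∑-delta points-enumerates e (𝟙 ∘ E)) (𝟙-T e∈E)) ⟩
    n + q * 1
      ≡⟨ cong (n +_) (*-identityʳ q) ⟩
    n + q ∎
    where
    open ≡-Reasoning
    distribute : ∀ a b c → a * (1 + b * c) ≡ a + b * (c * a)
    distribute = solve-∀

  -- The window defining 𝓛, as a condition on k = |ℓ ∩ E|: by definition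
  -- inL F E p d is rightSize (lineSize p d).
  rightSize : ℕ → Bool
  rightSize k = (2 ≤ᵇ k) ∧ ((2 * q + n ≤ᵇ 2 * q * k) ∧ (q * k ≤ᵇ 2 * n))

  isPartner : Pt F → Pt F → Bool
  isPartner e x = not (does (_≟ₚ_ F e x)) ∧ supported F E e x

  partners : Pt F → ℕ
  partners e = ∑[ x ← points F ] 𝟙 (E x ∧ isPartner e x)

  ordered-as-sum : orderedSupportedPairs F E ≡ ∑[ e ← points F ] (𝟙 (E e) * partners e)
  ordered-as-sum = begin
    orderedSupportedPairs F E
      ≡⟨ length-filter _ (cartesianProduct (points F) (points F)) ⟩
    ∑[ ex ← cartesianProduct (points F) (points F) ] 𝟙 (pair ex)
      ≡⟨ ∑-cartesian (points F) (points F) _ ⟩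
    ∑[ e ← points F ] ∑[ x ← points F ] 𝟙 (E e ∧ (E x ∧ isPartner e x))
      ≡⟨ ∑-cong (points F) (λ e → trans (∑-cong (points F) (λ x → 𝟙-∧ (E e) (E x ∧ isPartner e x)))
                                        (∑-*ˡ (points F) (𝟙 (E e)) (λ x → 𝟙 (E x ∧ isPartner e x)))) ⟩
    ∑[ e ← points F ] (𝟙 (E e) * partners e) ∎
    where
    open ≡-Reasoning
    pair : Pt F × Pt F → Bool
    pair (e , x) = E e ∧ (E x ∧ isPartner e x)

  goodLines : Pt F → ℕ
  goodLines e = ∑[ d ← directions ] 𝟙 (rightSize (lineSize e d))

  good-lines-through : ∀ e x → ∑[ d ← directions ] (𝟙 (rightSize (lineSize e d)) * 𝟙 (onLine F e d x))
                               ≡ 𝟙 (isPartner e x) + 𝟙 (does (_≟ₚ_ F x e)) * goodLines e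
  good-lines-through e x with _≟ₚ_ F x e | _≟ₚ_ F e x
  ... | yes refl | no e≢e = ⊥-elim (e≢e refl)
  ... | no x≢e   | yes refl = ⊥-elim (x≢e refl)
  ... | yes refl | yes _ = begin
    ∑[ d ← directions ] (𝟙 (rightSize (lineSize x d)) * 𝟙 (onLine F x d x))
      ≡⟨ ∑-cong directions (λ d → trans (cong (𝟙 (rightSize (lineSize x d)) *_) (𝟙-T (base-on-line x d))) (*-identityʳ _)) ⟩
    goodLines x
      ≡⟨ *-identityˡ (goodLines x) ⟨
    1 * goodLines x ∎
    where open ≡-Reasoning
  ... | no x≢e   | no _ = begin
    ∑[ d ← directions ] (𝟙 (rightSize (lineSize e d)) * 𝟙 (onLine F e d x))
      ≡⟨ ∑-cong directions on-line-through ⟩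
    ∑[ d ← directions ] (𝟙 (onLine F e d x) * 𝟙 (supported F E e x))
      ≡⟨ ∑-*ʳ directions _ (λ d → 𝟙 (onLine F e d x)) ⟩
    ∑[ d ← directions ] 𝟙 (onLine F e d x) * 𝟙 (supported F E e x)
      ≡⟨ cong (_* 𝟙 (supported F E e x)) (one-direction x≢e) ⟩
    1 * 𝟙 (supported F E e x)
      ≡⟨ *-identityˡ _ ⟩
    𝟙 (supported F E e x)
      ≡⟨ +-identityʳ _ ⟨
    𝟙 (supported F E e x) + 0 ∎
    where
    open ≡-Reasoning
    on-line-through : ∀ d → 𝟙 (rightSize (lineSize e d)) * 𝟙 (onLine F e d x) ≡ 𝟙 (onLine F e d x) * 𝟙 (supported F E e x)
    on-line-through d with onLine F e d x in e→x
    ... | false = *-zeroʳ (𝟙 (rightSize (lineSize e d)))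
    ... | true  = trans (*-identityʳ _) (trans (cong (𝟙 ∘ rightSize) (sym (lineSize-cong (line-through (true⇒T e→x) x≢e))))
                                                (sym (*-identityˡ _)))

  partners-by-lines : ∀ {e} → T (E e) →
    partners e + goodLines e ≡ ∑[ d ← directions ] (𝟙 (rightSize (lineSize e d)) * lineSize e d)
  partners-by-lines {e} e∈E = sym (begin
    ∑[ d ← directions ] (good d * lineSize e d)
      ≡⟨ ∑-cong directions (λ d → trans (cong (good d *_) (lineSize-as-sum e d)) (sym (∑-*ˡ (points F) (good d) _))) ⟩
    ∑[ d ← directions ] ∑[ x ← points F ] (good d * (𝟙 (E x) * 𝟙 (onLine F e d x)))
      ≡⟨ ∑-swap directions (points F) _ ⟩
    ∑[ x ← points F ] ∑[ d ← directions ] (good d * (𝟙 (E x) * 𝟙 (onLine F e d x)))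
      ≡⟨ ∑-cong (points F) (λ x → trans (∑-cong directions (λ d → exchange (good d) (𝟙 (E x)) (𝟙 (onLine F e d x))))
                                        (∑-*ˡ directions (𝟙 (E x)) (λ d → good d * 𝟙 (onLine F e d x)))) ⟩
    ∑[ x ← points F ] (𝟙 (E x) * ∑[ d ← directions ] (good d * 𝟙 (onLine F e d x)))
      ≡⟨ ∑-cong (points F) (λ x → trans (cong (𝟙 (E x) *_) (good-lines-through e x)) (*-distribˡ-+ (𝟙 (E x)) _ _)) ⟩
    ∑[ x ← points F ] (𝟙 (E x) * 𝟙 (isPartner e x) + 𝟙 (E x) * (𝟙 (does (_≟ₚ_ F x e)) * goodLines e))
      ≡⟨ ∑-+ (points F) (λ x → 𝟙 (E x) * 𝟙 (isPartner e x)) (λ x → 𝟙 (E x) * (𝟙 (does (_≟ₚ_ F x e)) * goodLines e)) ⟩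
    ∑[ x ← points F ] (𝟙 (E x) * 𝟙 (isPartner e x)) + ∑[ x ← points F ] (𝟙 (E x) * (𝟙 (does (_≟ₚ_ F x e)) * goodLines e))
      ≡⟨ cong₂ _+_ (∑-cong (points F) (λ x → sym (𝟙-∧ (E x) (isPartner e x))))
                   (trans (∑-cong (points F) (λ x → exchange (𝟙 (E x)) (𝟙 (does (_≟ₚ_ F x e))) (goodLines e)))
                          (∑-delta points-enumerates e (λ x → 𝟙 (E x) * goodLines e))) ⟩
    partners e + 𝟙 (E e) * goodLines e
      ≡⟨ cong (λ c → partners e + c * goodLines e) (𝟙-T e∈E) ⟩
    partners e + 1 * goodLines e
      ≡⟨ cong (partners e +_) (*-identityˡ (goodLines e)) ⟩
    partners e + goodLines e ∎)
    where
    open ≡-Reasoning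
    good : Pt F → ℕ
    good d = 𝟙 (rightSize (lineSize e d))
    exchange : ∀ a b c → a * (b * c) ≡ b * (a * c)
    exchange = solve-∀

  -- The points of E on the lines through e outside 𝓛, counted once per
  -- such line; summed over e ∈ E this is Σ_{ℓ ∉ 𝓛} |ℓ ∩ E|².
  badMass : Pt F → ℕ
  badMass e = ∑[ d ← directions ] (𝟙 (not (rightSize (lineSize e d))) * lineSize e d)

  point-inequality : ∀ {e} → T (E e) → n ≤ partners e + 1 + badMass e
  point-inequality {e} e∈E = +-cancelˡ-≤ q n _ (begin
    q + n
      ≡⟨ +-comm q n ⟩
    n + q
      ≡⟨ pencil-sum e∈E ⟨
    ∑[ d ← directions ] lineSize e d
      ≡⟨ ∑-cong directions (λ d → 𝟙-split (rightSize (lineSize e d)) (lineSize e d)) ⟩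
    ∑[ d ← directions ] (𝟙 (rightSize (lineSize e d)) * lineSize e d + 𝟙 (not (rightSize (lineSize e d))) * lineSize e d)
      ≡⟨ ∑-+ directions (λ d → 𝟙 (rightSize (lineSize e d)) * lineSize e d) (λ d → 𝟙 (not (rightSize (lineSize e d))) * lineSize e d) ⟩
    ∑[ d ← directions ] (𝟙 (rightSize (lineSize e d)) * lineSize e d) + badMass e
      ≡⟨ cong (_+ badMass e) (partners-by-lines e∈E) ⟨
    partners e + goodLines e + badMass e
      ≤⟨ +-monoˡ-≤ (badMass e) (+-monoʳ-≤ (partners e) at-most-all) ⟩
    partners e + suc q + badMass e
      ≡⟨ regroup (partners e) q (badMass e) ⟩
    q + (partners e + 1 + badMass e) ∎)
    where
    open ≤-Reasoning
    at-most-all : goodLines e ≤ suc q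
    at-most-all = begin
      goodLines e                ≤⟨ ∑-mono directions (λ d → 𝟙≤1 (rightSize (lineSize e d))) ⟩
      ∑[ d ← directions ] 1      ≡⟨ trans (∑-const directions 1) (*-identityʳ _) ⟩
      length directions          ≡⟨ length-directions ⟩
      suc q                      ∎
    regroup : ∀ a q b → a + suc q + b ≡ q + (a + 1 + b)
    regroup = solve-∀

  totalBadMass : ℕ
  totalBadMass = ∑[ e ← points F ] (𝟙 (E e) * badMass e)

  pair-inequality : n * n ≤ orderedSupportedPairs F E + n + totalBadMass
  pair-inequality = begin
    n * n
      ≡⟨ cong (_* n) card-as-sum ⟩
    ∑[ e ← points F ] 𝟙 (E e) * n
      ≡⟨ ∑-*ʳ (points F) n (𝟙 ∘ E) ⟨
    ∑[ e ← points F ] (𝟙 (E e) * n)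
      ≤⟨ ∑-mono (points F) at-point ⟩
    ∑[ e ← points F ] (𝟙 (E e) * partners e + 𝟙 (E e) + 𝟙 (E e) * badMass e)
      ≡⟨ trans (∑-+ (points F) (λ e → 𝟙 (E e) * partners e + 𝟙 (E e)) (λ e → 𝟙 (E e) * badMass e))
              (cong (_+ totalBadMass) (∑-+ (points F) (λ e → 𝟙 (E e) * partners e) (𝟙 ∘ E))) ⟩
    ∑[ e ← points F ] (𝟙 (E e) * partners e) + ∑[ e ← points F ] 𝟙 (E e) + totalBadMass
      ≡⟨ cong₂ (λ G m → G + m + totalBadMass) ordered-as-sum card-as-sum ⟨
    orderedSupportedPairs F E + n + totalBadMass ∎
    where
    open ≤-Reasoning
    at-point : ∀ e → 𝟙 (E e) * n ≤ 𝟙 (E e) * partners e + 𝟙 (E e) + 𝟙 (E e) * badMass e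
    at-point e with E e in e∈E
    ... | false = z≤n
    ... | true  = begin
      1 * n                                        ≡⟨ *-identityˡ n ⟩
      n                                            ≤⟨ point-inequality (true⇒T e∈E) ⟩
      partners e + 1 + badMass e                   ≡⟨ cong₂ (λ a b → a + 1 + b) (*-identityˡ (partners e)) (*-identityˡ (badMass e)) ⟨
      1 * partners e + 1 + 1 * badMass e           ∎

  -- The sum of f(|ℓ ∩ E|) over all based lines (p , d); every line of the
  -- plane occurs q times.
  lineSum : (ℕ → ℕ) → ℕ
  lineSum f = ∑[ d ← directions ] ∑[ p ← points F ] f (lineSize p d)

  lineSum-mono : ∀ {f g : ℕ → ℕ} → (∀ k → f k ≤ g k) → lineSum f ≤ lineSum g
  lineSum-mono f≤g = ∑-mono directions (λ d → ∑-mono (points F) (λ p → f≤g (lineSize p d)))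

  lineSum-+ : ∀ f g → lineSum (λ k → f k + g k) ≡ lineSum f + lineSum g
  lineSum-+ f g = trans (∑-cong directions (λ d → ∑-+ (points F) (f ∘ flip lineSize d) (g ∘ flip lineSize d)))
                        (∑-+ directions (λ d → ∑[ p ← points F ] f (lineSize p d)) (λ d → ∑[ p ← points F ] g (lineSize p d)))

  lineSum-* : ∀ c f → lineSum (λ k → c * f k) ≡ c * lineSum f
  lineSum-* c f = trans (∑-cong directions (λ d → ∑-*ˡ (points F) c (f ∘ flip lineSize d)))
                        (∑-*ˡ directions c (λ d → ∑[ p ← points F ] f (lineSize p d)))

  ∑-over-E : ∀ {f : Pt F → ℕ} {c : ℕ} → (∀ {x} → T (E x) → f x ≡ c) → ∑[ x ← points F ] (𝟙 (E x) * f x) ≡ n * c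
  ∑-over-E {f} {c} const = begin
    ∑[ x ← points F ] (𝟙 (E x) * f x) ≡⟨ ∑-cong (points F) on-E ⟩
    ∑[ x ← points F ] (𝟙 (E x) * c)   ≡⟨ ∑-*ʳ (points F) c (𝟙 ∘ E) ⟩
    ∑[ x ← points F ] 𝟙 (E x) * c     ≡⟨ cong (_* c) card-as-sum ⟨
    n * c                             ∎
    where
    open ≡-Reasoning
    on-E : ∀ x → 𝟙 (E x) * f x ≡ 𝟙 (E x) * c
    on-E x with E x in x∈E
    ... | false = refl
    ... | true  = cong (1 *_) (const (true⇒T x∈E))

  bad-moment : lineSum (λ k → k * (𝟙 (not (rightSize k)) * k)) ≡ q * totalBadMass
  bad-moment = incidences (λ k → 𝟙 (not (rightSize k)) * k)

  second-moment : lineSum (λ k → k * k) ≡ q * (n * (n + q))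
  second-moment = trans (incidences (λ k → k)) (cong (q *_) (∑-over-E {λ x → ∑[ d ← directions ] lineSize x d} pencil-sum))

  first-moment : lineSum (λ k → k * 1) ≡ q * (n * suc q)
  first-moment = trans (incidences (λ _ → 1)) (cong (q *_) (∑-over-E {λ _ → ∑[ d ← directions ] 1} (λ _ → all-directions)))
    where
    all-directions : ∑[ d ← directions ] 1 ≡ suc q
    all-directions = trans (∑-const directions 1) (trans (*-identityʳ (length directions)) length-directions)

  zeroth-moment : lineSum (λ _ → 1) ≡ suc q * (q * q)
  zeroth-moment = trans (∑-cong directions (λ _ → points-count))
                        (trans (∑-const directions (q * q)) (cong (_* (q * q)) length-directions))

  outside : ∀ k → rightSize k ≡ false → k < 2 ⊎ 2 * q * k < 2 * q + n ⊎ 2 * n < q * k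
  outside k bad with 2 ≤ᵇ k in few | 2 * q + n ≤ᵇ 2 * q * k in poor | q * k ≤ᵇ 2 * n in rich
  ... | false | _     | _     = inj₁ (≤ᵇ-false few)
  ... | true  | false | _     = inj₂ (inj₁ (≤ᵇ-false poor))
  ... | true  | true  | false = inj₂ (inj₂ (≤ᵇ-false rich))

  -- Weighted by q², every line satisfies
  --   q² [ℓ ∉ 𝓛] k² + 32 q n k ≤ 16 (q² k² + n²):
  -- for ℓ ∈ 𝓛 this is AM-GM, otherwise qk is far from n.
  line-inequality : 4 * q ≤ n → ∀ k →
    q * q * (k * (𝟙 (not (rightSize k)) * k)) + 32 * q * n * (k * 1) ≤ 16 * (q * q * (k * k) + n * n * 1)
  line-inequality 4q≤n k with rightSize k in size
  ... | true  = subst₂ _≤_ (good-lhs q n k) (rhs q n k) (am-gm (q * k) n)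
    where
    good-lhs : ∀ q n k → 32 * (q * k) * n ≡ q * q * (k * (0 * k)) + 32 * q * n * (k * 1)
    good-lhs = solve-∀
    rhs : ∀ q n k → 16 * ((q * k) * (q * k) + n * n) ≡ 16 * (q * q * (k * k) + n * n * 1)
    rhs = solve-∀
  ... | false = subst₂ _≤_ (bad-lhs q n k) (rhs q n k) (far-line q n k 4q≤n (outside k size))
    where
    bad-lhs : ∀ q n k → (q * k) * (q * k) + 32 * (q * k) * n ≡ q * q * (k * (1 * k)) + 32 * q * n * (k * 1)
    bad-lhs = solve-∀
    rhs : ∀ q n k → 16 * ((q * k) * (q * k) + n * n) ≡ 16 * (q * q * (k * k) + n * n * 1)
    rhs = solve-∀

  variance-inequality : 4 * q ≤ n →
    q * q * (q * totalBadMass) + 32 * q * n * (q * (n * suc q)) ≤ 16 * (q * q * (q * (n * (n + q))) + n * n * (suc q * (q * q)))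
  variance-inequality 4q≤n = begin
    q * q * (q * totalBadMass) + 32 * q * n * (q * (n * suc q))
      ≡⟨ cong₂ _+_ (cong (q * q *_) bad-moment) (cong (32 * q * n *_) first-moment) ⟨
    q * q * lineSum badSquare + 32 * q * n * lineSum linear
      ≡⟨ cong₂ _+_ (lineSum-* (q * q) badSquare) (lineSum-* (32 * q * n) linear) ⟨
    lineSum (λ k → q * q * badSquare k) + lineSum (λ k → 32 * q * n * linear k)
      ≡⟨ lineSum-+ (λ k → q * q * badSquare k) (λ k → 32 * q * n * linear k) ⟨
    lineSum (λ k → q * q * badSquare k + 32 * q * n * linear k)
      ≤⟨ lineSum-mono (line-inequality 4q≤n) ⟩
    lineSum (λ k → 16 * (q * q * square k + n * n * one k))
      ≡⟨ lineSum-* 16 (λ k → q * q * square k + n * n * one k) ⟩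
    16 * lineSum (λ k → q * q * square k + n * n * one k)
      ≡⟨ cong (16 *_) (lineSum-+ (λ k → q * q * square k) (λ k → n * n * one k)) ⟩
    16 * (lineSum (λ k → q * q * square k) + lineSum (λ k → n * n * one k))
      ≡⟨ cong (16 *_) (cong₂ _+_ (lineSum-* (q * q) square) (lineSum-* (n * n) one)) ⟩
    16 * (q * q * lineSum square + n * n * lineSum one)
      ≡⟨ cong (16 *_) (cong₂ _+_ (cong (q * q *_) second-moment) (cong (n * n *_) zeroth-moment)) ⟩
    16 * (q * q * (q * (n * (n + q))) + n * n * (suc q * (q * q))) ∎
    where
    open ≤-Reasoning
    badSquare linear square one : ℕ → ℕ
    badSquare k = k * (𝟙 (not (rightSize k)) * k)
    linear    k = k * 1
    square    k = k * k
    one       _ = 1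

module SupportedPairs where
  open NatArithmetic
  open import Data.Nat using (_+_; s≤s; z≤n; NonZero; >-nonZero)
  open import Data.Nat.Properties using (≤-trans; *-monoˡ-≤; +-monoʳ-≤; m≤m+n)

  supported-pairs-bound : (F : FiniteField) → 1024 ≤ FiniteField.size F → (E : Pt F → Bool) →
    FiniteField.size F ^ (64 * FiniteField.size F) ≤ 2 ^ card F E → card F E * card F E ≤ 4 * unorderedSupportedPairs F E
  supported-pairs-bound F 1024≤q E q^64q≤2^n =
    pair-count-bound q n (orderedSupportedPairs F E) 1≤q (below-640q (m≤m+n 40 600)) few-bad-pairs
    where
    open Incidences F E
    1≤q : 1 ≤ q
    1≤q = ≤-trans (s≤s z≤n) 1024≤q
    instance
      q≢0 : NonZero q
      q≢0 = >-nonZero 1≤q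
    640q≤n : 640 * q ≤ n
    640q≤n = log-bound q n 1024≤q q^64q≤2^n
    below-640q : ∀ {c} → c ≤ 640 → c * q ≤ n
    below-640q c≤640 = ≤-trans (*-monoˡ-≤ q c≤640) 640q≤n
    bad-mass≤ : totalBadMass ≤ 16 * q * n
    bad-mass≤ = bad-mass-bound q n totalBadMass (variance-inequality (below-640q (m≤m+n 4 636)))
    few-bad-pairs : n * n ≤ orderedSupportedPairs F E + n + 16 * q * n
    few-bad-pairs = ≤-trans pair-inequality (+-monoʳ-≤ _ bad-mass≤)

lemma3p4 : ∃[ C ] ((F : FiniteField) → C ≤ FiniteField.size F → (E : Pt F → Bool) → FiniteField.size F ^ (64 * FiniteField.size F) ≤ 2 ^ card F E → card F E * card F E ≤ 4 * unorderedSupportedPairs F E)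
lemma3p4 = 1024 , SupportedPairs.supported-pairs-bound
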